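{- Let $q$ be a prime power with $\mathrm{char}(\mathbb{F}_q)\neq 3$ and suppose $-3$ is a square in $\mathbb{F}_q$. Let $\mathcal{Q}=\mathbb{F}_q^3$ with commuting relation $(x_1,y_1,z_1)$ commutes with $(x_2,y_2,z_2)$ iff $x_1y_2-y_1x_2=z_1-z_2$. Then $\mathcal{Q}$ contains a non-commuting subset of size more than $4q-12$.
   Context: A subset of $\mathcal{Q}$ is non-commuting if no two distinct elements commute. -}

module Defs where

open import Level using (Level; _⊔_)
open import Algebra.Bundles using (CommutativeRing)
open import Data.Nat using (ℕ)
open import Data.Fin using (Fin)
open import Data.Product using (_×_; _,_; ∃)
open import Relation.Nullary using (¬_)
open import Relation.Binary.PropositionalEquality using (_≡_)

record IsFiniteField {c ℓ : Level} (R : CommutativeRing c ℓ) (q : ℕ) : Set (c ⊔ ℓ) where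
  open CommutativeRing R
  field
    1≉0 : ¬ (1# ≈ 0#)
    inverse : ∀ x → ¬ (x ≈ 0#) → ∃ λ y → x * y ≈ 1#
    enum : Fin q → Carrier
    enum-injective : ∀ i j → enum i ≈ enum j → i ≡ j
    enum-surjective : ∀ x → ∃ λ i → enum i ≈ x

module Q {c ℓ : Level} (R : CommutativeRing c ℓ) where
  open CommutativeRing R

  Point : Set c
  Point = Carrier × Carrier × Carrier

  _≈P_ : Point → Point → Set ℓ
  (x₁ , y₁ , z₁) ≈P (x₂ , y₂ , z₂) = (x₁ ≈ x₂) × (y₁ ≈ y₂) × (z₁ ≈ z₂)

  Commutes : Point → Point → Set ℓ
  Commutes (x₁ , y₁ , z₁) (x₂ , y₂ , z₂) = x₁ * y₂ - y₁ * x₂ ≈ z₁ - z₂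

  NonCommutingSubset : ℕ → Set (c ⊔ ℓ)
  NonCommutingSubset N =
    ∃ λ (S : Fin N → Point) →
      (∀ i j → S i ≈P S j → i ≡ j) ×
      (∀ i j → ¬ (i ≡ j) → ¬ Commutes (S i) (S j))

  three : Carrier
  three = 1# + 1# + 1#

-- For q ≥ 3 fix distinct y₁, y₂, y₃ ∈ F and consider the lines
--   ℓ(y, a) = { (t, y, a(t+1)) : t ∈ F }   and the diagonal   D = { (0, s, s) }.
-- Two points of one line ℓ(y, a) with y ≠ a never commute, and neither do two
-- points of D.  A point of ℓ(y, a) with t ≠ −1 commutes with (0, s, s) only
-- for s = a.  A point (s, y₂, ·) of ℓ(y₂, y₃) commuting with some point of
-- ℓ(y₁, y₂) has y₃s + y₃ = y₂ + y₁s, which for y₃ ≠ y₁ pins s down to a single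
-- exceptional value.  So the lines ℓ(y₁,y₂), ℓ(y₂,y₃), ℓ(y₃,y₁), each without
-- the parameter −1 and its exceptional parameter, together with D without the
-- points s ∈ {y₁,y₂,y₃}, form a non-commuting set of size at least
-- 3(q − 2) + (q − 3) = 4q − 9 > 4q − 12.  For q < 3 the empty set suffices.

module Submission where

open import Defs
open import Level using (Level; _⊔_)
open import Algebra.Bundles using (CommutativeRing)
open import Data.Nat using (ℕ; suc)
import Data.Nat.Properties as ℕ
open import Data.Nat.Tactic.RingSolver using (solve-∀)
open import Data.Product using (_×_; _,_; ∃; proj₁; proj₂)
open import Data.Empty using (⊥-elim)
open import Data.Sum using (_⊎_; inj₁; inj₂; [_,_]′)
open import Data.Fin using (Fin; splitAt; join; punchIn) renaming (zero to fzero; suc to fsuc)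
import Data.Fin.Properties as Fin
open import Data.Vec.Functional using (_++_)
open import Data.List using (List; []; _∷_; length) renaming (_++_ to _++ˡ_)
open import Data.List.Properties using (length-++)
open import Data.List.Relation.Unary.All using (All; []; _∷_; head; tail)
open import Data.List.Relation.Unary.All.Properties using (++⁺)
open import Function using (_∘_; id)
open import Function.Definitions using (Injective)
open import Relation.Nullary using (¬_; yes; no)
open import Relation.Unary using (Pred)
import Relation.Unary as U
open import Relation.Binary using (Setoid; Decidable; _Respects_)
open import Relation.Binary.PropositionalEquality using (_≡_; _≢_)
import Relation.Binary.PropositionalEquality as ≡

module Commutation {c ℓ} (R : CommutativeRing c ℓ) where
  open CommutativeRing R
  open Q R
  open import Relation.Binary.Reasoning.Setoid setoid
  open import Algebra.Properties.Group +-group using (//-rightDividesˡ; x≈y⇒x∙y⁻¹≈ε)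
  open import Algebra.Properties.AbelianGroup +-abelianGroup using (⁻¹-anti-homo‿-)
  open import Algebra.Solver.Ring.NaturalCoefficients.Default commutativeSemiring
    using (solve; _:+_; _:=_)

  differences⇒sums : ∀ {a b c d} → a - b ≈ c - d → a + d ≈ c + b
  differences⇒sums {a} {b} {c} {d} h = begin
    a + d                ≈⟨ +-congʳ (//-rightDividesˡ b a) ⟨
    ((a - b) + b) + d    ≈⟨ +-congʳ (+-congʳ h) ⟩
    ((c - d) + b) + d    ≈⟨ solve 3 (λ u v w → (u :+ v) :+ w := (u :+ w) :+ v) refl (c - d) b d ⟩
    ((c - d) + d) + b    ≈⟨ +-congʳ (//-rightDividesˡ d c) ⟩
    c + b                ∎

  commutes⇒sums : ∀ {x₁ y₁ z₁ x₂ y₂ z₂} → Commutes (x₁ , y₁ , z₁) (x₂ , y₂ , z₂) →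
                  x₁ * y₂ + z₂ ≈ z₁ + y₁ * x₂
  commutes⇒sums = differences⇒sums

  commutes-sym : ∀ {p p′} → Commutes p p′ → Commutes p′ p
  commutes-sym {x₁ , y₁ , z₁} {x₂ , y₂ , z₂} h = begin
    x₂ * y₁ - y₂ * x₁       ≈⟨ +-cong (*-comm x₂ y₁) (-‿cong (*-comm y₂ x₁)) ⟩
    y₁ * x₂ - x₁ * y₂       ≈⟨ ⁻¹-anti-homo‿- (x₁ * y₂) (y₁ * x₂) ⟨
    - (x₁ * y₂ - y₁ * x₂)   ≈⟨ -‿cong h ⟩
    - (z₁ - z₂)             ≈⟨ ⁻¹-anti-homo‿- z₁ z₂ ⟩
    z₂ - z₁                 ∎

  commutes-refl : ∀ {p p′} → p ≈P p′ → Commutes p p′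
  commutes-refl {x₁ , y₁ , z₁} {x₂ , y₂ , z₂} (x₁≈x₂ , y₁≈y₂ , z₁≈z₂) = begin
    x₁ * y₂ - y₁ * x₂   ≈⟨ x≈y⇒x∙y⁻¹≈ε (trans (*-comm x₁ y₂) (*-cong (sym y₁≈y₂) x₁≈x₂)) ⟩
    0#                  ≈⟨ x≈y⇒x∙y⁻¹≈ε z₁≈z₂ ⟨
    z₁ - z₂             ∎

  NonCommuting : ∀ {i} {I : Set i} → (I → Point) → Set (i ⊔ ℓ)
  NonCommuting {I = I} S = ∀ (i j : I) → i ≢ j → ¬ Commutes (S i) (S j)

  Apart : ∀ {i j} {I : Set i} {J : Set j} → (I → Point) → (J → Point) → Set (i ⊔ j ⊔ ℓ)
  Apart S T = ∀ i j → ¬ Commutes (S i) (T j)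

  nonCommuting⇒subset : ∀ {n} (S : Fin n → Point) → NonCommuting S → NonCommutingSubset n
  nonCommuting⇒subset S S-nc = S , injective , S-nc
    where
      injective : ∀ i j → S i ≈P S j → i ≡ j
      injective i j Si≈Sj with i Fin.≟ j
      ... | yes i≡j = i≡j
      ... | no i≢j  = ⊥-elim (S-nc i j i≢j (commutes-refl Si≈Sj))

  nonCommuting-reindex : ∀ {i j} {I : Set i} {J : Set j} {S : I → Point} (f : J → I) →
                         Injective _≡_ _≡_ f → NonCommuting S → NonCommuting (S ∘ f)
  nonCommuting-reindex f f-inj S-nc i j i≢j = S-nc (f i) (f j) (i≢j ∘ f-inj)

  nonCommuting-⊎ : ∀ {i j} {I : Set i} {J : Set j} {S : I → Point} {T : J → Point} →
                   NonCommuting S → NonCommuting T → Apart S T → NonCommuting [ S , T ]′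
  nonCommuting-⊎ S-nc T-nc S#T (inj₁ i) (inj₁ j) i≢j = S-nc i j (i≢j ∘ ≡.cong inj₁)
  nonCommuting-⊎ S-nc T-nc S#T (inj₁ i) (inj₂ j) _   = S#T i j
  nonCommuting-⊎ S-nc T-nc S#T (inj₂ i) (inj₁ j) _   = S#T j i ∘ commutes-sym
  nonCommuting-⊎ S-nc T-nc S#T (inj₂ i) (inj₂ j) i≢j = T-nc i j (i≢j ∘ ≡.cong inj₂)

  -- Fin (m + n) ≅ Fin m ⊎ Fin n, so splitting an index loses no information.
  splitAt-injective : ∀ m {n} → Injective _≡_ _≡_ (splitAt m {n})
  splitAt-injective m {n} {i} {j} eq =
    ≡.trans (≡.sym (Fin.join-splitAt m n i)) (≡.trans (≡.cong (join m n) eq) (Fin.join-splitAt m n j))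

  nonCommuting-++ : ∀ {m n} {S : Fin m → Point} {T : Fin n → Point} →
                    NonCommuting S → NonCommuting T → Apart S T → NonCommuting (S ++ T)
  nonCommuting-++ {m} S-nc T-nc S#T =
    nonCommuting-reindex (splitAt m) (splitAt-injective m) (nonCommuting-⊎ S-nc T-nc S#T)

  apart-++ : ∀ {i} {I : Set i} {m n} {S : I → Point} {T : Fin m → Point} {U : Fin n → Point} →
             Apart S T → Apart S U → Apart S (T ++ U)
  apart-++ {m = m} S#T S#U i j with splitAt m j
  ... | inj₁ j′ = S#T i j′
  ... | inj₂ j′ = S#U i j′

module FiniteField {c ℓ} (F : CommutativeRing c ℓ) {q : ℕ} (𝔽 : IsFiniteField F q) where
  open CommutativeRing F
  open IsFiniteField 𝔽
  open import Relation.Binary.Reasoning.Setoid setoid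
  open import Algebra.Properties.Group +-group using (//-rightDividesˡ; x∙y⁻¹≈ε⇒x≈y; ∙-cancelʳ)
  open import Algebra.Solver.Ring.NaturalCoefficients.Default commutativeSemiring
    using (solve; _:+_; _:*_; _:=_)

  -- Equality is decidable: compare the indices of the two elements.
  infix 4 _≟_
  _≟_ : Decidable _≈_
  x ≟ y with enum-surjective x | enum-surjective y
  ... | i , eᵢ≈x | j , eⱼ≈y with i Fin.≟ j
  ... | yes ≡.refl = yes (trans (sym eᵢ≈x) eⱼ≈y)
  ... | no i≢j   = no λ x≈y → i≢j (enum-injective i j (trans eᵢ≈x (trans x≈y (sym eⱼ≈y))))

  *-cancelˡ : ∀ {d u v} → ¬ d ≈ 0# → d * u ≈ d * v → u ≈ v
  *-cancelˡ {d} {u} {v} d≉0 du≈dv with inverse d d≉0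
  ... | d′ , dd′≈1 = begin
    u                ≈⟨ divide u ⟩
    d′ * (d * u)     ≈⟨ *-congˡ du≈dv ⟩
    d′ * (d * v)     ≈⟨ divide v ⟨
    v                ∎
    where
      divide : ∀ w → w ≈ d′ * (d * w)
      divide w = begin
        w              ≈⟨ *-identityˡ w ⟨
        1# * w         ≈⟨ *-congʳ dd′≈1 ⟨
        (d * d′) * w   ≈⟨ solve 3 (λ a b x → (a :* b) :* x := b :* (a :* x)) refl d d′ w ⟩
        d′ * (d * w)   ∎

  -- pu + qv = qu + pv says (p − q)(u − v) = 0, so p = q or u = v.
  exchange : ∀ {p q u v} → p * u + q * v ≈ q * u + p * v → p ≈ q ⊎ u ≈ v
  exchange {p} {q} {u} {v} h with p ≟ q
  ... | yes p≈q = inj₁ p≈q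
  ... | no p≉q  = inj₂ (*-cancelˡ (p≉q ∘ x∙y⁻¹≈ε⇒x≈y p q) (∙-cancelʳ (q * u + q * v) _ _ shifted))
    where
      d : Carrier
      d = p - q
      p≈d+q : p ≈ d + q
      p≈d+q = sym (//-rightDividesˡ q p)
      shifted : d * u + (q * u + q * v) ≈ d * v + (q * u + q * v)
      shifted = begin
        d * u + (q * u + q * v)   ≈⟨ solve 4 (λ d q u v → d :* u :+ (q :* u :+ q :* v) := (d :+ q) :* u :+ q :* v) refl d q u v ⟩
        (d + q) * u + q * v       ≈⟨ +-congʳ (*-congʳ p≈d+q) ⟨
        p * u + q * v             ≈⟨ h ⟩
        q * u + p * v             ≈⟨ +-congˡ (*-congʳ p≈d+q) ⟩
        q * u + (d + q) * v       ≈⟨ solve 4 (λ d q u v → q :* u :+ (d :+ q) :* v := d :* v :+ (q :* u :+ q :* v)) refl d q u v ⟩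
        d * v + (q * u + q * v)   ∎

  -- The first enumerated element satisfying a decidable predicate, or 0# if
  -- there is none.
  candidate : ∀ {p} {P : Pred Carrier p} → U.Decidable P → Carrier
  candidate P? with Fin.any? (λ k → P? (enum k))
  ... | yes (k , _) = enum k
  ... | no _        = 0#

  candidate-unique : ∀ {p} {P : Pred Carrier p} (P? : U.Decidable P) →
                     P Respects _≈_ → (∀ {s r} → P s → P r → s ≈ r) →
                     ∀ {s} → P s → s ≈ candidate P?
  candidate-unique P? resp unique {s} Ps with Fin.any? (λ k → P? (enum k))
  ... | yes (k , Pk) = unique Ps Pk
  ... | no none      = ⊥-elim (none (index , resp (sym enum-index≈s) Ps))
    where
      index : Fin q
      index = proj₁ (enum-surjective s)
      enum-index≈s : enum index ≈ s
      enum-index≈s = proj₂ (enum-surjective s)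

module Lines {c ℓ} (F : CommutativeRing c ℓ) {q : ℕ} (𝔽 : IsFiniteField F q) where
  open CommutativeRing F
  open Q F
  open Commutation F
  open FiniteField F 𝔽
  open import Relation.Binary.Reasoning.Setoid setoid
  open import Algebra.Properties.Group +-group using (∙-cancelʳ; inverseˡ-unique)
  open import Algebra.Solver.Ring.NaturalCoefficients.Default commutativeSemiring
    using (solve; _:+_; _:*_; _:=_; con)

  line : Carrier → Carrier → Carrier → Point
  line y a t = t , y , a * (t + 1#)

  diagonal : Carrier → Point
  diagonal s = 0# , s , s

  line-line : ∀ {y a t t′} → Commutes (line y a t) (line y a t′) → y ≈ a ⊎ t ≈ t′
  line-line {y} {a} {t} {t′} h = exchange (∙-cancelʳ a _ _ (begin
    (y * t + a * t′) + a    ≈⟨ solve 4 (λ y a t t′ → (y :* t :+ a :* t′) :+ a := t :* y :+ a :* (t′ :+ con 1)) refl y a t t′ ⟩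
    t * y + a * (t′ + 1#)   ≈⟨ commutes⇒sums h ⟩
    a * (t + 1#) + y * t′   ≈⟨ solve 4 (λ y a t t′ → a :* (t :+ con 1) :+ y :* t′ := (a :* t :+ y :* t′) :+ a) refl y a t t′ ⟩
    (a * t + y * t′) + a    ∎))

  diagonal-diagonal : ∀ {s s′} → Commutes (diagonal s) (diagonal s′) → s ≈ s′
  diagonal-diagonal {s} {s′} h = sym (begin
    s′               ≈⟨ solve 2 (λ s s′ → s′ := con 0 :* s′ :+ s′) refl s s′ ⟩
    0# * s′ + s′     ≈⟨ commutes⇒sums h ⟩
    s + s * 0#       ≈⟨ solve 2 (λ s s′ → s :+ s :* con 0 := s) refl s s′ ⟩
    s                ∎)

  line-diagonal : ∀ {y a t s} → Commutes (line y a t) (diagonal s) → t ≈ - 1# ⊎ s ≈ a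
  line-diagonal {y} {a} {t} {s} h = [ inj₂ , inj₁ ∘ inverseˡ-unique t 1# ]′ (exchange (begin
    s * (t + 1#) + a * 0#   ≈⟨ solve 4 (λ y a t s → s :* (t :+ con 1) :+ a :* con 0 := t :* s :+ s) refl y a t s ⟩
    t * s + s               ≈⟨ commutes⇒sums h ⟩
    a * (t + 1#) + y * 0#   ≈⟨ solve 4 (λ y a t s → a :* (t :+ con 1) :+ y :* con 0 := a :* (t :+ con 1) :+ s :* con 0) refl y a t s ⟩
    a * (t + 1#) + s * 0#   ∎))

  line-diagonal-apart : ∀ {y a t s} → ¬ t ≈ - 1# → ¬ s ≈ a → ¬ Commutes (line y a t) (diagonal s)
  line-diagonal-apart t≉-1 s≉a = [ t≉-1 , s≉a ]′ ∘ line-diagonal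

  Chain : Carrier → Carrier → Carrier → Carrier → Set ℓ
  Chain y₁ y₂ y₃ s = y₃ * s + y₃ ≈ y₂ + y₁ * s

  line-line-chain : ∀ {y₁ y₂ y₃ t s} → Commutes (line y₁ y₂ t) (line y₂ y₃ s) → Chain y₁ y₂ y₃ s
  line-line-chain {y₁} {y₂} {y₃} {t} {s} h = ∙-cancelʳ (t * y₂) _ _ (begin
    (y₃ * s + y₃) + t * y₂    ≈⟨ solve 5 (λ y₁ y₂ y₃ t s → (y₃ :* s :+ y₃) :+ t :* y₂ := t :* y₂ :+ y₃ :* (s :+ con 1)) refl y₁ y₂ y₃ t s ⟩
    t * y₂ + y₃ * (s + 1#)    ≈⟨ commutes⇒sums h ⟩
    y₂ * (t + 1#) + y₁ * s    ≈⟨ solve 5 (λ y₁ y₂ y₃ t s → y₂ :* (t :+ con 1) :+ y₁ :* s := (y₂ :+ y₁ :* s) :+ t :* y₂) refl y₁ y₂ y₃ t s ⟩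
    (y₂ + y₁ * s) + t * y₂    ∎)

  chain-unique : ∀ {y₁ y₂ y₃ s r} → ¬ y₃ ≈ y₁ → Chain y₁ y₂ y₃ s → Chain y₁ y₂ y₃ r → s ≈ r
  chain-unique {y₁} {y₂} {y₃} {s} {r} y₃≉y₁ Cs Cr = [ ⊥-elim ∘ y₃≉y₁ , id ]′ (exchange (∙-cancelʳ (y₃ + y₂) _ _ (begin
    (y₃ * s + y₁ * r) + (y₃ + y₂)    ≈⟨ solve 5 (λ y₁ y₂ y₃ s r → (y₃ :* s :+ y₁ :* r) :+ (y₃ :+ y₂) := (y₃ :* s :+ y₃) :+ (y₂ :+ y₁ :* r)) refl y₁ y₂ y₃ s r ⟩
    (y₃ * s + y₃) + (y₂ + y₁ * r)    ≈⟨ +-cong Cs (sym Cr) ⟩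
    (y₂ + y₁ * s) + (y₃ * r + y₃)    ≈⟨ solve 5 (λ y₁ y₂ y₃ s r → (y₂ :+ y₁ :* s) :+ (y₃ :* r :+ y₃) := (y₁ :* s :+ y₃ :* r) :+ (y₃ :+ y₂)) refl y₁ y₂ y₃ s r ⟩
    (y₁ * s + y₃ * r) + (y₃ + y₂)    ∎)))

  chain? : ∀ y₁ y₂ y₃ → U.Decidable (Chain y₁ y₂ y₃)
  chain? y₁ y₂ y₃ s = y₃ * s + y₃ ≟ y₂ + y₁ * s

  chain-respects : ∀ {y₁ y₂ y₃} → Chain y₁ y₂ y₃ Respects _≈_
  chain-respects s≈s′ C = trans (+-congʳ (*-congˡ (sym s≈s′))) (trans C (+-congˡ (*-congˡ s≈s′)))

  -- the only parameter of ℓ(y₂, y₃) that can commute with ℓ(y₁, y₂) when y₃ ≠ y₁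
  exceptional : Carrier → Carrier → Carrier → Carrier
  exceptional y₁ y₂ y₃ = candidate (chain? y₁ y₂ y₃)

  line-line-apart : ∀ {y₁ y₂ y₃ t s} → ¬ y₃ ≈ y₁ → ¬ s ≈ exceptional y₁ y₂ y₃ →
                    ¬ Commutes (line y₁ y₂ t) (line y₂ y₃ s)
  line-line-apart {y₁} {y₂} {y₃} y₃≉y₁ s≉r h =
    s≉r (candidate-unique (chain? y₁ y₂ y₃) chain-respects (chain-unique y₃≉y₁) (line-line-chain h))

-- From here on _+_, _*_ denote the operations on ℕ.
open import Data.Nat using (_<_; _+_; _*_; _≤_; s≤s)

-- Removing finitely many values from an injective family E : Fin m → A over a
-- setoid with decidable equality: every value is hit at most once, so avoiding
-- the values bs costs at most length bs indices.
module Thinning {a ℓ} (S : Setoid a ℓ) (_≟_ : Decidable (Setoid._≈_ S)) where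
  open Setoid S

  record Thinned {m : ℕ} (E : Fin m → Carrier) (bs : List Carrier) : Set (a ⊔ ℓ) where
    field
      size           : ℕ
      large          : m ≤ length bs + size
      pick           : Fin size → Fin m
      pick-injective : Injective _≡_ _≡_ pick
      avoids         : ∀ j → All (λ b → ¬ E (pick j) ≈ b) bs
  open Thinned public

  keep-all : ∀ {m} (E : Fin m → Carrier) → Thinned E []
  keep-all {m} E = record
    { size = m ; large = ℕ.≤-refl ; pick = id ; pick-injective = id ; avoids = λ _ → [] }

  -- Drop the index k carrying the value b; by injectivity no other index
  -- carries b.
  drop-index : ∀ {m b} (E : Fin m → Carrier) → Injective _≡_ _≈_ E →
               ∀ k → E k ≈ b → Thinned E (b ∷ [])
  drop-index {suc m} E E-inj k Ek≈b = record
    { size           = m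
    ; large          = ℕ.≤-refl
    ; pick           = punchIn k
    ; pick-injective = Fin.punchIn-injective k _ _
    ; avoids         = λ j → (λ E[j]≈b → Fin.punchInᵢ≢i k j (E-inj (trans E[j]≈b (sym Ek≈b)))) ∷ []
    }

  drop-value : ∀ {m} (E : Fin m → Carrier) → Injective _≡_ _≈_ E → ∀ b → Thinned E (b ∷ [])
  drop-value {m} E E-inj b with Fin.any? (λ k → E k ≟ b)
  ... | yes (k , Ek≈b) = drop-index E E-inj k Ek≈b
  ... | no none        = record
    { size = m ; large = ℕ.n≤1+n m ; pick = id ; pick-injective = id
    ; avoids = λ j → (λ E[j]≈b → none (j , E[j]≈b)) ∷ [] }

  compose : ∀ {m bs cs} {E : Fin m → Carrier} (T : Thinned E bs) →
            Thinned (E ∘ pick T) cs → Thinned E (cs ++ˡ bs)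
  compose {m} {bs} {cs} T U = record
    { size           = size U
    ; large          = large′
    ; pick           = pick T ∘ pick U
    ; pick-injective = pick-injective U ∘ pick-injective T
    ; avoids         = λ j → ++⁺ (avoids U j) (avoids T (pick U j))
    }
    where
      open ℕ.≤-Reasoning
      large′ : m ≤ length (cs ++ˡ bs) + size U
      large′ = begin
        m                                 ≤⟨ large T ⟩
        length bs + size T                ≤⟨ ℕ.+-monoʳ-≤ (length bs) (large U) ⟩
        length bs + (length cs + size U)  ≡⟨ ≡.sym (ℕ.+-assoc (length bs) (length cs) (size U)) ⟩
        (length bs + length cs) + size U  ≡⟨ ≡.cong (_+ size U) (ℕ.+-comm (length bs) (length cs)) ⟩
        (length cs + length bs) + size U  ≡⟨ ≡.cong (_+ size U) (≡.sym (length-++ cs)) ⟩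
        length (cs ++ˡ bs) + size U       ∎

  thin : ∀ {m} (E : Fin m → Carrier) → Injective _≡_ _≈_ E → ∀ bs → Thinned E bs
  thin E E-inj []       = keep-all E
  thin E E-inj (b ∷ bs) = compose T (drop-value (E ∘ pick T) (pick-injective T ∘ E-inj) b)
    where T = thin E E-inj bs

four-blocks : ∀ q m₁ m₂ m₃ m₄ → q ≤ 2 + m₁ → q ≤ 2 + m₂ → q ≤ 2 + m₃ → q ≤ 3 + m₄ →
              4 * q < (m₁ + (m₂ + (m₃ + m₄))) + 12
four-blocks q m₁ m₂ m₃ m₄ h₁ h₂ h₃ h₄ = begin-strict
  4 * q                                               ≤⟨ ℕ.+-mono-≤ h₁ (ℕ.+-mono-≤ h₂ (ℕ.+-mono-≤ h₃ (ℕ.+-mono-≤ h₄ ℕ.≤-refl))) ⟩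
  (2 + m₁) + ((2 + m₂) + ((2 + m₃) + ((3 + m₄) + 0))) ≡⟨ regroup m₁ m₂ m₃ m₄ ⟩
  (m₁ + (m₂ + (m₃ + m₄))) + 9                         <⟨ ℕ.+-monoʳ-< (m₁ + (m₂ + (m₃ + m₄))) (ℕ.m≤m+n 10 2) ⟩
  (m₁ + (m₂ + (m₃ + m₄))) + 12                        ∎
  where
    open ℕ.≤-Reasoning
    regroup : ∀ a b c d → (2 + a) + ((2 + b) + ((2 + c) + ((3 + d) + 0))) ≡ (a + (b + (c + d))) + 9
    regroup = solve-∀

module Assembly {c ℓ} (F : CommutativeRing c ℓ) {q : ℕ} (𝔽 : IsFiniteField F q) where
  open CommutativeRing F using (Carrier; _≈_; setoid; -_; 1#)
  open IsFiniteField 𝔽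
  open Q F
  open Commutation F
  open FiniteField F 𝔽
  open Lines F 𝔽
  open Thinning setoid _≟_

  Parameters : List Carrier → Set (c ⊔ ℓ)
  Parameters bs = Thinned enum bs

  parameters : ∀ bs → Parameters bs
  parameters = thin enum (enum-injective _ _)

  parameter : ∀ {bs} (T : Parameters bs) → Fin (size T) → Carrier
  parameter T = enum ∘ pick T

  parameter-injective : ∀ {bs} (T : Parameters bs) → Injective _≡_ _≈_ (parameter T)
  parameter-injective T = pick-injective T ∘ enum-injective _ _

  lineFamily : ∀ {bs} → Carrier → Carrier → (T : Parameters bs) → Fin (size T) → Point
  lineFamily y a T = line y a ∘ parameter T

  diagonalFamily : ∀ {bs} (T : Parameters bs) → Fin (size T) → Point
  diagonalFamily T = diagonal ∘ parameter T

  lineFamily-nonCommuting : ∀ {bs y a} (T : Parameters bs) → ¬ y ≈ a → NonCommuting (lineFamily y a T)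
  lineFamily-nonCommuting T y≉a i j i≢j h = [ y≉a , i≢j ∘ parameter-injective T ]′ (line-line h)

  diagonalFamily-nonCommuting : ∀ {bs} (T : Parameters bs) → NonCommuting (diagonalFamily T)
  diagonalFamily-nonCommuting T i j i≢j h = i≢j (parameter-injective T (diagonal-diagonal h))

  avoids-−1 : ∀ {r} (T : Parameters (- 1# ∷ r ∷ [])) j → ¬ parameter T j ≈ - 1#
  avoids-−1 T j = head (avoids T j)

  avoids-exceptional : ∀ {r} (T : Parameters (- 1# ∷ r ∷ [])) j → ¬ parameter T j ≈ r
  avoids-exceptional T j = head (tail (avoids T j))

  module Triangle (y₁ y₂ y₃ : Carrier) (y₁≉y₂ : ¬ y₁ ≈ y₂) (y₂≉y₃ : ¬ y₂ ≈ y₃) (y₃≉y₁ : ¬ y₃ ≈ y₁) where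
    -- Each line drops the parameter −1 (where it could meet the diagonal) and
    -- the exceptional parameter (where it could meet the previous line).
    T₁ : Parameters (- 1# ∷ exceptional y₃ y₁ y₂ ∷ [])
    T₁ = parameters _
    T₂ : Parameters (- 1# ∷ exceptional y₁ y₂ y₃ ∷ [])
    T₂ = parameters _
    T₃ : Parameters (- 1# ∷ exceptional y₂ y₃ y₁ ∷ [])
    T₃ = parameters _
    -- The diagonal drops the values at which it meets the three lines.
    T₄ : Parameters (y₁ ∷ y₂ ∷ y₃ ∷ [])
    T₄ = parameters _

    apart₁₂ : Apart (lineFamily y₁ y₂ T₁) (lineFamily y₂ y₃ T₂)
    apart₁₂ i j = line-line-apart y₃≉y₁ (avoids-exceptional T₂ j)

    apart₁₃ : Apart (lineFamily y₁ y₂ T₁) (lineFamily y₃ y₁ T₃)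
    apart₁₃ i j = line-line-apart y₂≉y₃ (avoids-exceptional T₁ i) ∘ commutes-sym

    apart₂₃ : Apart (lineFamily y₂ y₃ T₂) (lineFamily y₃ y₁ T₃)
    apart₂₃ i j = line-line-apart y₁≉y₂ (avoids-exceptional T₃ j)

    -- The parameters of T₄ avoid y₁, y₂, y₃, in this order.
    apart₁₄ : Apart (lineFamily y₁ y₂ T₁) (diagonalFamily T₄)
    apart₁₄ i j = line-diagonal-apart (avoids-−1 T₁ i) (head (tail (avoids T₄ j)))

    apart₂₄ : Apart (lineFamily y₂ y₃ T₂) (diagonalFamily T₄)
    apart₂₄ i j = line-diagonal-apart (avoids-−1 T₂ i) (head (tail (tail (avoids T₄ j))))

    apart₃₄ : Apart (lineFamily y₃ y₁ T₃) (diagonalFamily T₄)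
    apart₃₄ i j = line-diagonal-apart (avoids-−1 T₃ i) (head (avoids T₄ j))

    points : Fin (size T₁ + (size T₂ + (size T₃ + size T₄))) → Point
    points = lineFamily y₁ y₂ T₁ ++ (lineFamily y₂ y₃ T₂ ++ (lineFamily y₃ y₁ T₃ ++ diagonalFamily T₄))

    points-nonCommuting : NonCommuting points
    points-nonCommuting =
      nonCommuting-++ (lineFamily-nonCommuting T₁ y₁≉y₂)
        (nonCommuting-++ (lineFamily-nonCommuting T₂ y₂≉y₃)
          (nonCommuting-++ (lineFamily-nonCommuting T₃ y₃≉y₁) (diagonalFamily-nonCommuting T₄) apart₃₄)
          (apart-++ apart₂₃ apart₂₄))
        (apart-++ apart₁₂ (apart-++ apart₁₃ apart₁₄))

    large-subset : ∃ λ N → (4 * q < N + 12) × NonCommutingSubset N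
    large-subset = _ , four-blocks q _ _ _ _ (large T₁) (large T₂) (large T₃) (large T₄)
                     , nonCommuting⇒subset points points-nonCommuting

  enum-distinct : ∀ {i j} → i ≢ j → ¬ enum i ≈ enum j
  enum-distinct i≢j = i≢j ∘ enum-injective _ _

  large-subset : 3 ≤ q → ∃ λ N → (4 * q < N + 12) × NonCommutingSubset N
  large-subset (s≤s (s≤s (s≤s _))) =
    Triangle.large-subset (enum fzero) (enum (fsuc fzero)) (enum (fsuc (fsuc fzero)))
      (enum-distinct (λ ())) (enum-distinct (λ ())) (enum-distinct (λ ()))

empty-suffices : ∀ {c ℓ} (F : CommutativeRing c ℓ) q → q < 3 →
                 ∃ λ N → (4 * q < N + 12) × Q.NonCommutingSubset F N
empty-suffices F q q<3 = 0 , ℕ.*-monoʳ-< 4 q<3 , (λ ()) , (λ ()) , (λ ())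

lemma7p7 : ∀ {c ℓ : Level} (F : CommutativeRing c ℓ) (q : ℕ) → IsFiniteField F q →
             ¬ (CommutativeRing._≈_ F (Q.three F) (CommutativeRing.0# F)) →
             (∃ λ s → CommutativeRing._≈_ F (CommutativeRing._*_ F s s) (CommutativeRing.-_ F (Q.three F))) →
             ∃ λ N → (4 * q < N + 12) × Q.NonCommutingSubset F N
lemma7p7 F q 𝔽 _ _ with q ℕ.<? 3
... | yes q<3 = empty-suffices F q q<3
... | no q≮3  = Assembly.large-subset F 𝔽 (ℕ.≮⇒≥ q≮3)
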